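{- For infinitely many positive integers $n$ there is an Eulerian digraph $G$ with $n$ vertices and $m$ arcs, where $m/n \ge \sqrt{n}/20$, such that some DFS tree of $G$ has depth $4$, i.e. every path in that tree starting at its root has at most $4$ vertices.
   Context: Digraphs are finite and simple (no loops or multiple arcs; opposite arcs allowed). A digraph is Eulerian if every vertex has in-degree equal to its out-degree. A depth-first search (DFS) on a digraph $G$ maintains a set $S$ of finished vertices, a set $T$ of unvisited vertices (initially $T=V(G)$), and a stack $U$ (initially empty). While $S \ne V(G)$: if $U$ is nonempty, let $v$ be the top of $U$; if $v$ has an out-neighbour $u\in T$, push $u$ onto $U$ (removing it from $T$) and record $v$ as the parent of $u$; otherwise pop $v$ from $U$ into $S$. If $U$ is empty, push an arbitrary vertex of $T$ (which becomes a root). A DFS tree is the rooted forest/tree formed by the parent relations produced by some run of this procedure; its depth is the maximum number of vertices on a path from a root. -}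

module Defs where

open import Data.Nat using (ℕ; zero; suc; _+_)
open import Data.Bool using (Bool; true; false)
open import Data.Fin using (Fin; _≟_)
open import Data.Fin.Subset using (Subset; _∈_; _∉_; _∪_; _-_; ⁅_⁆; ⊤; ⊥)
open import Data.List using (List; []; _∷_; map; allFin)
open import Data.Nat.ListAction using (sum)
open import Data.Product using (Σ; ∃₂)
open import Data.Maybe using (Maybe; just; nothing; _>>=_)
open import Relation.Nullary using (yes; no)
open import Relation.Binary.PropositionalEquality using (_≡_)

-- A finite simple digraph on vertex set Fin n: arc u v ≡ true iff u → v is an arc.
-- No loops; opposite arcs are allowed; no multiple arcs (arcs form a relation).
record Digraph (n : ℕ) : Set where
  field
    arc      : Fin n → Fin n → Bool
    loopless : ∀ v → arc v v ≡ false
open Digraph public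

boolToℕ : Bool → ℕ
boolToℕ true  = 1
boolToℕ false = 0

outDeg : ∀ {n} → Digraph n → Fin n → ℕ
outDeg {n} G v = sum (map (λ u → boolToℕ (arc G v u)) (allFin n))

inDeg : ∀ {n} → Digraph n → Fin n → ℕ
inDeg {n} G v = sum (map (λ u → boolToℕ (arc G u v)) (allFin n))

arcCount : ∀ {n} → Digraph n → ℕ
arcCount {n} G = sum (map (outDeg G) (allFin n))

Eulerian : ∀ {n} → Digraph n → Set
Eulerian {n} G = ∀ v → inDeg G v ≡ outDeg G v

-- DFS state: finished set S, unvisited set T, stack U, parent function.
record DFSState (n : ℕ) : Set where
  constructor st
  field
    S      : Subset n
    T      : Subset n
    U      : List (Fin n)
    parent : Fin n → Maybe (Fin n)

setParent : ∀ {n} → (Fin n → Maybe (Fin n)) → Fin n → Fin n → (Fin n → Maybe (Fin n))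
setParent p u v w with w ≟ u
... | yes _ = just v
... | no  _ = p w

initState : ∀ n → DFSState n
initState n = st ⊥ ⊤ [] (λ _ → nothing)

data DFSStep {n : ℕ} (G : Digraph n) : DFSState n → DFSState n → Set where
  push : ∀ {S T U p v u} → u ∈ T → arc G v u ≡ true →
         DFSStep G (st S T (v ∷ U) p) (st S (T - u) (u ∷ v ∷ U) (setParent p u v))
  pop  : ∀ {S T U p v} → (∀ u → u ∈ T → arc G v u ≡ false) →
         DFSStep G (st S T (v ∷ U) p) (st (S ∪ ⁅ v ⁆) T U p)
  root : ∀ {S T p u} → u ∈ T →
         DFSStep G (st S T [] p) (st S (T - u) (u ∷ []) p)

data DFSRun {n : ℕ} (G : Digraph n) : DFSState n → DFSState n → Set where
  done : ∀ {s} → DFSRun G s s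
  step : ∀ {s t r} → DFSStep G s t → DFSRun G t r → DFSRun G s r

-- A parent function is a DFS tree (forest) of G if some complete DFS run
-- (loop runs while S ≠ V(G), so it stops exactly when S = V(G)) produces it.
IsDFSTree : ∀ {n} → Digraph n → (Fin n → Maybe (Fin n)) → Set
IsDFSTree {n} G p = ∃₂ λ (T : Subset n) (U : List (Fin n)) → DFSRun G (initState n) (st ⊤ T U p)

ancestor : ∀ {n} → (Fin n → Maybe (Fin n)) → ℕ → Fin n → Maybe (Fin n)
ancestor p zero    v = just v
ancestor p (suc k) v = ancestor p k v >>= p

-- depth ≤ d (d ≥ 1): every root-path has at most d vertices,
-- i.e. no vertex has a d-th ancestor.
DepthAtMost : ∀ {n} → (Fin n → Maybe (Fin n)) → ℕ → Set
DepthAtMost {n} p d = ∀ (v : Fin n) → ancestor p d v ≡ nothing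

module Submission where

-- For w = N + 1 we build an explicit Eulerian digraph G on n = 3 + 8w²
-- vertices: a spine 0 ⇄ 1 ⇄ 2, and 8w² leaves, each joined to 2 in both directions.
-- The leaves are arranged in 8w blocks of w, and leaf arcs only go from a block to the
-- previous one, with a capacity tapering to 0 at both ends; this keeps the in- and
-- out-degree of every leaf within one of each other, and the remaining unit of
-- imbalance is repaired by an arc to or from vertex 0 (which is then balanced by the
-- handshake lemma).  The 4w middle blocks give at least 4w³ arcs, enough for
-- n³ ≤ (20m)².  Since leaf arcs point backwards, DFS from 0 along the spine can visit
-- the leaves from 2 in increasing order, each immediately finished, giving a tree of
-- depth 4.

open import Defs
open import Data.Nat hiding (_≟_)
open import Data.Nat.Properties renaming (_≟_ to _≟ℕ_)
open import Data.Nat.DivMod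
open import Data.Nat.Divisibility using (n∣m*n)
open import Data.Nat.ListAction using (sum)
open import Data.Nat.Solver using (module +-*-Solver)
open import Algebra.Properties.CommutativeSemigroup +-commutativeSemigroup using (interchange)
open import Data.Bool using (Bool; true; false; _∧_)
open import Data.Fin using (Fin; zero; suc; toℕ; fromℕ<)
open import Data.Fin.Properties using (toℕ<n; toℕ-injective; toℕ-fromℕ<; _≟_)
open import Data.Fin.Subset using (Subset; _∈_; _∉_; _⊆_; _∪_; _-_; ⁅_⁆; ⊤; ⊥)
open import Data.Fin.Subset.Properties
  using (∈⊤; x∈⁅x⁆; x∈p∪q⁺; p⊆p∪q; p─q⊆p; x∈p∧x≢y⇒x∈p-y; ⊆-antisym; ⊆⊤)
open import Data.Vec using (_∷_; there)
open import Data.List using (List; []; _∷_; map; allFin; tabulate)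
open import Data.List.Properties using (map-tabulate)
open import Data.Maybe using (Maybe; just; nothing; _>>=_)
open import Data.Product using (Σ; _×_; _,_; proj₁; proj₂)
open import Data.Sum using (_⊎_; inj₁; inj₂)
open import Data.Empty using (⊥-elim)
open import Function using (_∘′_)
open import Relation.Nullary using (yes; no)
open import Relation.Nullary.Decidable using (does; dec-true; dec-false)
open import Relation.Binary.PropositionalEquality

open +-*-Solver using (solve; _:+_; _:*_; _:^_; _:=_; con)

sumTo : ℕ → (ℕ → ℕ) → ℕ
sumTo zero    f = 0
sumTo (suc n) f = f 0 + sumTo n (λ k → f (suc k))

sumTo-cong : ∀ n {f g : ℕ → ℕ} → (∀ k → k < n → f k ≡ g k) → sumTo n f ≡ sumTo n g
sumTo-cong zero    f≗g = refl
sumTo-cong (suc n) f≗g = cong₂ _+_ (f≗g 0 z<s) (sumTo-cong n (λ k k<n → f≗g (suc k) (s<s k<n)))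

sumTo-mono : ∀ n {f g : ℕ → ℕ} → (∀ k → k < n → f k ≤ g k) → sumTo n f ≤ sumTo n g
sumTo-mono zero    f≤g = z≤n
sumTo-mono (suc n) f≤g = +-mono-≤ (f≤g 0 z<s) (sumTo-mono n (λ k k<n → f≤g (suc k) (s<s k<n)))

sumTo-zero : ∀ n {f : ℕ → ℕ} → (∀ k → k < n → f k ≡ 0) → sumTo n f ≡ 0
sumTo-zero zero    f≗0 = refl
sumTo-zero (suc n) f≗0 = cong₂ _+_ (f≗0 0 z<s) (sumTo-zero n (λ k k<n → f≗0 (suc k) (s<s k<n)))

sumTo-const : ∀ n c → sumTo n (λ _ → c) ≡ n * c
sumTo-const zero    c = refl
sumTo-const (suc n) c = cong (c +_) (sumTo-const n c)

sumTo-+ : ∀ n (f g : ℕ → ℕ) → sumTo n (λ k → f k + g k) ≡ sumTo n f + sumTo n g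
sumTo-+ zero    f g = refl
sumTo-+ (suc n) f g = trans (cong (f 0 + g 0 +_) (sumTo-+ n _ _)) (interchange (f 0) (g 0) _ _)

sumTo-split : ∀ m k (f : ℕ → ℕ) → sumTo (m + k) f ≡ sumTo m f + sumTo k (λ i → f (m + i))
sumTo-split zero    k f = refl
sumTo-split (suc m) k f =
  trans (cong (f 0 +_) (sumTo-split m k (λ i → f (suc i)))) (sym (+-assoc (f 0) _ _))

sumTo-swap : ∀ n m (f : ℕ → ℕ → ℕ) →
  sumTo n (λ x → sumTo m (λ y → f x y)) ≡ sumTo m (λ y → sumTo n (λ x → f x y))
sumTo-swap zero    m f = sym (sumTo-zero m (λ _ _ → refl))
sumTo-swap (suc n) m f =
  trans (cong (sumTo m (f 0) +_) (sumTo-swap n m (λ x → f (suc x))))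
        (sym (sumTo-+ m (f 0) (λ y → sumTo n (λ x → f (suc x) y))))

sumTo-single : ∀ n t (f : ℕ → ℕ) → t < n → (∀ i → i ≢ t → f i ≡ 0) → sumTo n f ≡ f t
sumTo-single (suc n) zero f t<n f≗0 =
  trans (cong (f 0 +_) (sumTo-zero n (λ k _ → f≗0 (suc k) (λ ())))) (+-identityʳ (f 0))
sumTo-single (suc n) (suc t) f t<n f≗0 =
  trans (cong (_+ sumTo n (λ k → f (suc k))) (f≗0 0 (λ ())))
        (sumTo-single n t (λ k → f (suc k)) (s<s⁻¹ t<n) (λ i i≢t → f≗0 (suc i) (i≢t ∘′ suc-injective)))

sumTo-blocks : ∀ B w (h : ℕ → ℕ) → sumTo (B * w) h ≡ sumTo B (λ b → sumTo w (λ q → h (b * w + q)))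
sumTo-blocks zero    w h = refl
sumTo-blocks (suc B) w h =
  trans (sumTo-split w (B * w) h)
        (cong (sumTo w h +_)
              (trans (sumTo-blocks B w (λ i → h (w + i)))
                     (sumTo-cong B (λ b _ → sumTo-cong w (λ q _ → cong h (sym (+-assoc w (b * w) q)))))))

sumTo-divMod : ∀ B w .{{_ : NonZero w}} (F : ℕ → ℕ → ℕ) →
  sumTo (B * w) (λ k → F (k / w) (k % w)) ≡ sumTo B (λ b → sumTo w (λ q → F b q))
sumTo-divMod B w F =
  trans (sumTo-blocks B w _)
        (sumTo-cong B (λ b _ → sumTo-cong w (λ q q<w → cong₂ F (block b q q<w) (offset b q q<w))))
  where
  block : ∀ b q → q < w → (b * w + q) / w ≡ b
  block b q q<w = begin
      (b * w + q) / w     ≡⟨ +-distrib-/-∣ˡ q (n∣m*n b) ⟩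
      b * w / w + q / w   ≡⟨ cong₂ _+_ (m*n/n≡m b w) (m<n⇒m/n≡0 q<w) ⟩
      b + 0               ≡⟨ +-identityʳ b ⟩
      b                   ∎
    where open ≡-Reasoning
  offset : ∀ b q → q < w → (b * w + q) % w ≡ q
  offset b q q<w = trans (cong (_% w) (+-comm (b * w) q)) (trans ([m+kn]%n≡m%n q b w) (m<n⇒m%n≡m q<w))

count-below : ∀ w p c → sumTo w (λ q → boolToℕ (p + q <ᵇ c)) ≡ w ⊓ (c ∸ p)
count-below zero    p c = refl
count-below (suc w) p c =
  trans (cong (boolToℕ (p + 0 <ᵇ c) +_)
              (trans (sumTo-cong w (λ q _ → cong (λ t → boolToℕ (t <ᵇ c)) (+-suc p q)))
                     (count-below w (suc p) c)))
        (first-step p c)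
  where
  first-step : ∀ p c → boolToℕ (p + 0 <ᵇ c) + w ⊓ (c ∸ suc p) ≡ suc w ⊓ (c ∸ p)
  first-step zero    zero    = ⊓-zeroʳ w
  first-step zero    (suc c) = refl
  first-step (suc p) zero    = ⊓-zeroʳ w
  first-step (suc p) (suc c) = first-step p c

sum-allFin : ∀ n (H : Fin n → ℕ) (f : ℕ → ℕ) → (∀ u → H u ≡ f (toℕ u)) →
  sum (map H (allFin n)) ≡ sumTo n f
sum-allFin n H f H≗f = trans (cong sum (map-tabulate (λ u → u) H)) (sum-tabulate n H f H≗f)
  where
  sum-tabulate : ∀ n (H : Fin n → ℕ) (f : ℕ → ℕ) → (∀ u → H u ≡ f (toℕ u)) →
    sum (tabulate H) ≡ sumTo n f
  sum-tabulate zero    H f H≗f = refl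
  sum-tabulate (suc n) H f H≗f =
    cong₂ _+_ (H≗f zero) (sum-tabulate n (λ u → H (suc u)) (λ i → f (suc i)) (λ u → H≗f (suc u)))

Close : ℕ → ℕ → Set
Close a b = a ≤ suc b × b ≤ suc a

close-refl : ∀ a → Close a a
close-refl a = n≤1+n a , n≤1+n a

close-suc : ∀ a → Close a (suc a)
close-suc a = m≤n⇒m≤1+n (n≤1+n a) , ≤-refl

close-⊓ : ∀ {a b c d} → Close a b → Close c d → Close (a ⊓ c) (b ⊓ d)
close-⊓ (a≤b+1 , b≤a+1) (c≤d+1 , d≤c+1) = ⊓-mono-≤ a≤b+1 c≤d+1 , ⊓-mono-≤ b≤a+1 d≤c+1

close-∸ : ∀ {a b} p → Close a b → Close (a ∸ p) (b ∸ p)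
close-∸ {a} {b} p (a≤b+1 , b≤a+1) =
  ≤-trans (∸-monoˡ-≤ p a≤b+1) (suc∸ b p) , ≤-trans (∸-monoˡ-≤ p b≤a+1) (suc∸ a p)
  where
  suc∸ : ∀ y p → suc y ∸ p ≤ suc (y ∸ p)
  suc∸ y       zero    = ≤-refl
  suc∸ zero    (suc p) = subst (_≤ 1) (sym (0∸n≡0 p)) z≤n
  suc∸ (suc y) (suc p) = suc∸ y p

close-sym : ∀ {a b} → Close a b → Close b a
close-sym (a≤b+1 , b≤a+1) = b≤a+1 , a≤b+1

close-∸suc : ∀ B b → Close (B ∸ b) (B ∸ suc b)
close-∸suc zero    zero    = close-refl 0
close-∸suc (suc B) zero    = close-sym (close-suc B)
close-∸suc zero    (suc b) = close-refl 0
close-∸suc (suc B) (suc b) = close-∸suc B b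

top-up : ∀ {a b} → Close a b → boolToℕ (b <ᵇ a) + b ≡ boolToℕ (a <ᵇ b) + a
top-up {zero}        {zero}        _ = refl
top-up {zero}        {suc zero}    _ = refl
top-up {zero}        {suc (suc b)} (_ , s≤s ())
top-up {suc zero}    {zero}        _ = refl
top-up {suc (suc a)} {zero}        (s≤s () , _)
top-up {suc a}       {suc b}       (s≤s a≤b+1 , s≤s b≤a+1) =
  trans (+-suc (boolToℕ (b <ᵇ a)) b) (trans (cong suc (top-up (a≤b+1 , b≤a+1))) (sym (+-suc _ a)))

outRel inRel : ℕ → (ℕ → ℕ → Bool) → ℕ → ℕ
outRel n a x = sumTo n (λ y → boolToℕ (a x y))
inRel  n a x = sumTo n (λ y → boolToℕ (a y x))

-- Handshake lemma: total in-degree equals total out-degree, so if every vertex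
-- except 0 is balanced then 0 is balanced too.
balanced-at-0 : ∀ n a → (∀ x → suc x < n → inRel n a (suc x) ≡ outRel n a (suc x)) →
  inRel n a 0 ≡ outRel n a 0
balanced-at-0 zero    a _        = refl
balanced-at-0 (suc m) a balanced =
  +-cancelʳ-≡ (sumTo m (λ x → outRel n a (suc x))) (inRel n a 0) (outRel n a 0)
    (trans (cong (inRel n a 0 +_) (sym rest-balanced)) handshake)
  where
  n : ℕ
  n = suc m
  rest-balanced : sumTo m (λ x → inRel n a (suc x)) ≡ sumTo m (λ x → outRel n a (suc x))
  rest-balanced = sumTo-cong m (λ x x<m → balanced x (s<s x<m))
  handshake : sumTo n (inRel n a) ≡ sumTo n (outRel n a)
  handshake = sumTo-swap n n (λ x y → boolToℕ (a y x))

relDigraph : ∀ n (a : ℕ → ℕ → Bool) → (∀ k → a k k ≡ false) → Digraph n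
relDigraph n a irrefl = record { arc = λ x y → a (toℕ x) (toℕ y) ; loopless = λ x → irrefl (toℕ x) }

module _ (n : ℕ) (a : ℕ → ℕ → Bool) (irrefl : ∀ k → a k k ≡ false) where

  private G = relDigraph n a irrefl

  relDigraph-outDeg : ∀ x → outDeg G x ≡ outRel n a (toℕ x)
  relDigraph-outDeg x = sum-allFin n _ _ (λ _ → refl)

  relDigraph-inDeg : ∀ x → inDeg G x ≡ inRel n a (toℕ x)
  relDigraph-inDeg x = sum-allFin n _ _ (λ _ → refl)

  relDigraph-arcCount : arcCount G ≡ sumTo n (outRel n a)
  relDigraph-arcCount = sum-allFin n (outDeg G) (outRel n a) relDigraph-outDeg

  relDigraph-eulerian : (∀ x → suc x < n → inRel n a (suc x) ≡ outRel n a (suc x)) → Eulerian G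
  relDigraph-eulerian balanced x = begin
      inDeg G x             ≡⟨ relDigraph-inDeg x ⟩
      inRel n a (toℕ x)     ≡⟨ balanced-everywhere (toℕ x) (toℕ<n x) ⟩
      outRel n a (toℕ x)    ≡⟨ sym (relDigraph-outDeg x) ⟩
      outDeg G x            ∎
    where
    open ≡-Reasoning
    balanced-everywhere : ∀ y → y < n → inRel n a y ≡ outRel n a y
    balanced-everywhere zero    _   = balanced-at-0 n a balanced
    balanced-everywhere (suc y) y<n = balanced y y<n

Parent : ℕ → Set
Parent n = Fin n → Maybe (Fin n)

_++ᴿ_ : ∀ {n} {G : Digraph n} {s t r} → DFSRun G s t → DFSRun G t r → DFSRun G s r
done        ++ᴿ rest = rest
step s run  ++ᴿ rest = step s (run ++ᴿ rest)

setParent-here : ∀ {n} (p : Parent n) u v → setParent p u v u ≡ just v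
setParent-here p u v with u ≟ u
... | yes _   = refl
... | no  u≢u = ⊥-elim (u≢u refl)

setParent-elsewhere : ∀ {n} (p : Parent n) u v x → x ≢ u → setParent p u v x ≡ p x
setParent-elsewhere p u v x x≢u with x ≟ u
... | yes x≡u = ⊥-elim (x≢u x≡u)
... | no  _   = refl

x∉p-x : ∀ {n} (p : Subset n) (x : Fin n) → x ∉ p - x
x∉p-x (s ∷ p) zero    ()
x∉p-x (s ∷ p) (suc x) (there x∈p-x) = x∉p-x p x x∈p-x

IsTailFrom : ∀ {n} → ℕ → Subset n → Set
IsTailFrom j T = ∀ i → (i ∈ T → j ≤ toℕ i) × (j ≤ toℕ i → i ∈ T)

⊤-isTailFrom-0 : ∀ {n} → IsTailFrom 0 (⊤ {n})
⊤-isTailFrom-0 i = (λ _ → z≤n) , (λ _ → ∈⊤)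

tail-remove : ∀ {n j} {T : Subset n} x → IsTailFrom j T → toℕ x ≡ j → IsTailFrom (suc j) (T - x)
tail-remove {j = j} {T} x tail x≡j i = beyond , inside
  where
  index-differs : i ≢ x → toℕ i ≢ j
  index-differs i≢x i≡j = i≢x (toℕ-injective (trans i≡j (sym x≡j)))
  beyond : i ∈ T - x → suc j ≤ toℕ i
  beyond i∈ = ≤∧≢⇒< (proj₁ (tail i) (p─q⊆p T ⁅ x ⁆ i∈))
                    (λ j≡i → index-differs (λ { refl → x∉p-x T x i∈ }) (sym j≡i))
  inside : suc j ≤ toℕ i → i ∈ T - x
  inside j<i = x∈p∧x≢y⇒x∈p-y (proj₂ (tail i) (<⇒≤ j<i)) (λ i≡x → >⇒≢ j<i (trans (cong toℕ i≡x) x≡j))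

-- Sweeping a tail from a hub: if the hub h on top of the stack has an arc to every
-- vertex of index ≥ a, and no such vertex has an arc to a vertex of larger index, then
-- DFS can push and immediately pop these vertices in increasing order, each becoming a
-- child of h.
module Sweep {n} (G : Digraph n) (h : Fin n) (U : List (Fin n)) (a : ℕ)
  (hub-arcs : ∀ x → a ≤ toℕ x → arc G h x ≡ true)
  (no-forward-arcs : ∀ x y → a ≤ toℕ x → toℕ x < toℕ y → arc G x y ≡ false) where

  record Swept (S T : Subset n) (p : Parent n) (j : ℕ) : Set where
    field
      S′ T′        : Subset n
      p′           : Parent n
      run          : DFSRun G (st S T (h ∷ U) p) (st S′ T′ (h ∷ U) p′)
      exhausted    : ∀ i → i ∉ T′
      keeps-done   : S ⊆ S′
      finishes     : ∀ i → j ≤ toℕ i → i ∈ S′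
      keeps-parent : ∀ i → toℕ i < j → p′ i ≡ p i
      hub-parent   : ∀ i → j ≤ toℕ i → p′ i ≡ just h

  sweep : ∀ r j → r + j ≡ n → a ≤ j → ∀ {S T p} → IsTailFrom j T → Swept S T p j
  sweep zero j refl a≤j {S} {T} {p} tail = record
    { S′ = S ; T′ = T ; p′ = p ; run = done
    ; exhausted    = λ i i∈T → <⇒≱ (toℕ<n i) (proj₁ (tail i) i∈T)
    ; keeps-done   = λ i∈S → i∈S
    ; finishes     = λ i n≤i → ⊥-elim (<⇒≱ (toℕ<n i) n≤i)
    ; keeps-parent = λ _ _ → refl
    ; hub-parent   = λ i n≤i → ⊥-elim (<⇒≱ (toℕ<n i) n≤i) }
  sweep (suc r) j r+j≡n a≤j {S} {T} {p} tail = record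
    { S′ = S′ ; T′ = T′ ; p′ = p′
    ; run          = step (push x∈T (hub-arcs x a≤x)) (step (pop x-has-no-new-neighbour) run)
    ; exhausted    = exhausted
    ; keeps-done   = λ i∈S → keeps-done (p⊆p∪q ⁅ x ⁆ i∈S)
    ; finishes     = finishes′
    ; keeps-parent = keeps-parent′
    ; hub-parent   = hub-parent′ }
    where
    j<n : j < n
    j<n = ≤-trans (s≤s (m≤n+m j r)) (≤-reflexive r+j≡n)
    x : Fin n
    x = fromℕ< j<n
    x≡j : toℕ x ≡ j
    x≡j = toℕ-fromℕ< j<n
    a≤x : a ≤ toℕ x
    a≤x = subst (a ≤_) (sym x≡j) a≤j
    x∈T : x ∈ T
    x∈T = proj₂ (tail x) (≤-reflexive (sym x≡j))
    tail′ : IsTailFrom (suc j) (T - x)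
    tail′ = tail-remove x tail x≡j
    x-has-no-new-neighbour : ∀ u → u ∈ T - x → arc G x u ≡ false
    x-has-no-new-neighbour u u∈ =
      no-forward-arcs x u a≤x (subst (_< toℕ u) (sym x≡j) (proj₁ (tail′ u) u∈))
    index-differs : ∀ {i} → i ≢ x → j ≢ toℕ i
    index-differs i≢x j≡i = i≢x (toℕ-injective (trans (sym j≡i) (sym x≡j)))
    open Swept (sweep r (suc j) (trans (+-suc r j) r+j≡n) (m≤n⇒m≤1+n a≤j)
                      {S ∪ ⁅ x ⁆} {p = setParent p x h} tail′)
    finishes′ : ∀ i → j ≤ toℕ i → i ∈ S′
    finishes′ i j≤i with i ≟ x
    ... | yes refl = keeps-done (x∈p∪q⁺ (inj₂ (x∈⁅x⁆ x)))
    ... | no  i≢x  = finishes i (≤∧≢⇒< j≤i (index-differs i≢x))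
    keeps-parent′ : ∀ i → toℕ i < j → p′ i ≡ p i
    keeps-parent′ i i<j = trans (keeps-parent i (m≤n⇒m≤1+n i<j))
                                (setParent-elsewhere p x h i (λ { refl → <⇒≢ i<j x≡j }))
    hub-parent′ : ∀ i → j ≤ toℕ i → p′ i ≡ just h
    hub-parent′ i j≤i with i ≟ x
    ... | yes refl = trans (keeps-parent x (s≤s (≤-reflexive x≡j))) (setParent-here p x h)
    ... | no  i≢x  = hub-parent i (≤∧≢⇒< j≤i (index-differs i≢x))

ancestor-child : ∀ {n} (p : Parent n) {v u} k → p v ≡ just u → ancestor p (suc k) v ≡ ancestor p k u
ancestor-child p zero    pv≡u = pv≡u
ancestor-child p (suc k) pv≡u = cong (_>>= p) (ancestor-child p k pv≡u)

ancestor-root : ∀ {n} (p : Parent n) {v} k → p v ≡ nothing → ancestor p (suc k) v ≡ nothing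
ancestor-root p zero    pv≡nothing = pv≡nothing
ancestor-root p (suc k) pv≡nothing = cong (_>>= p) (ancestor-root p k pv≡nothing)

module _ {n} (p : Parent n) (rank : Fin n → ℕ)
  (ranked : ∀ v → p v ≡ nothing ⊎ Σ (Fin n) λ u → p v ≡ just u × rank v ≡ suc (rank u)) where

  no-ancestor-above-rank : ∀ k v → rank v ≤ k → ancestor p (suc k) v ≡ nothing
  no-ancestor-above-rank k v rv≤k with ranked v
  ... | inj₁ pv≡nothing = ancestor-root p k pv≡nothing
  ... | inj₂ (u , pv≡u , rv≡ru+1) with k
  ...   | zero   = ⊥-elim (n≮0 (subst (_≤ 0) rv≡ru+1 rv≤k))
  ...   | suc k′ = trans (ancestor-child p (suc k′) pv≡u)
                         (no-ancestor-above-rank k′ u (s≤s⁻¹ (subst (_≤ suc k′) rv≡ru+1 rv≤k)))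

  depth-from-rank : ∀ d → (∀ v → rank v < d) → DepthAtMost p d
  depth-from-rank zero    rank<0 v = ⊥-elim (n≮0 (rank<0 v))
  depth-from-rank (suc d) rank<d v = no-ancestor-above-rank d v (s≤s⁻¹ (rank<d v))

-- The extremal digraph for a parameter v, with w = v + 1.  Vertices 0, 1, 2 form a
-- spine (arcs 0 ⇄ 1 ⇄ 2); vertex 3 + k is the leaf k, viewed as block k / w < B = 8w
-- at offset k % w < w.
module Construction (v : ℕ) where

  w B L n : ℕ
  w = suc v
  B = 8 * w
  L = B * w
  n = 3 + L

  -- The capacity of a block, tapering to 0 at both ends so that degrees change slowly.
  cap : ℕ → ℕ
  cap b = b ⊓ (B ∸ b)

  leafArc : ℕ → ℕ → ℕ → ℕ → Bool
  leafArc b p b′ q = does (b ≟ℕ suc b′) ∧ (p + q <ᵇ cap b)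

  leafOut leafIn : ℕ → ℕ → ℕ
  leafOut b p = w ⊓ (cap b ∸ p)
  leafIn  b p = w ⊓ (cap (suc b) ∸ p)

  outᴸ inᴸ : ℕ → ℕ
  outᴸ k = leafOut (k / w) (k % w)
  inᴸ  k = leafIn  (k / w) (k % w)

  arcRel : ℕ → ℕ → Bool
  arcRel 0 0 = false
  arcRel 0 1 = true
  arcRel 0 2 = false
  arcRel 0 (suc (suc (suc j))) = inᴸ j <ᵇ outᴸ j
  arcRel 1 0 = true
  arcRel 1 1 = false
  arcRel 1 2 = true
  arcRel 1 (suc (suc (suc j))) = false
  arcRel 2 0 = false
  arcRel 2 1 = true
  arcRel 2 2 = false
  arcRel 2 (suc (suc (suc j))) = true
  arcRel (suc (suc (suc k))) 0 = outᴸ k <ᵇ inᴸ k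
  arcRel (suc (suc (suc k))) 1 = false
  arcRel (suc (suc (suc k))) 2 = true
  arcRel (suc (suc (suc k))) (suc (suc (suc j))) = leafArc (k / w) (k % w) (j / w) (j % w)

  leafDoubleSum : (ℕ → ℕ → ℕ) → ℕ
  leafDoubleSum F = sumTo B (λ b′ → sumTo w (λ q → F b′ q))

  leaf-out-degree : ∀ b p → b < B → leafDoubleSum (λ b′ q → boolToℕ (leafArc b p b′ q)) ≡ leafOut b p
  leaf-out-degree zero p _ =
    trans (sumTo-zero B (λ b′ _ → sumTo-zero w (λ q _ →
             cong (λ t → boolToℕ (t ∧ (p + q <ᵇ 0))) (dec-false (0 ≟ℕ suc b′) λ ()))))
          (sym (trans (cong (w ⊓_) (0∸n≡0 p)) (⊓-zeroʳ w)))
  leaf-out-degree (suc t) p t<B =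
    trans (sumTo-single B t _ (<-trans (n<1+n t) t<B) λ b′ b′≢t → sumTo-zero w λ q _ →
             cong (λ z → boolToℕ (z ∧ (p + q <ᵇ cap (suc t))))
                  (dec-false (suc t ≟ℕ suc b′) (b′≢t ∘′ sym ∘′ suc-injective)))
          (trans (sumTo-cong w λ q _ →
                    cong (λ z → boolToℕ (z ∧ (p + q <ᵇ cap (suc t)))) (dec-true (suc t ≟ℕ suc t) refl))
                 (count-below w p (cap (suc t))))

  leaf-in-degree : ∀ b p → b < B → leafDoubleSum (λ b′ q → boolToℕ (leafArc b′ q b p)) ≡ leafIn b p
  leaf-in-degree b p b<B with suc b <? B
  ... | yes b+1<B =
    trans (sumTo-single B (suc b) _ b+1<B λ b′ b′≢b+1 → sumTo-zero w λ q _ →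
             cong (λ z → boolToℕ (z ∧ (q + p <ᵇ cap b′))) (dec-false (b′ ≟ℕ suc b) b′≢b+1))
          (trans (sumTo-cong w λ q _ →
                    cong₂ (λ z y → boolToℕ (z ∧ (y <ᵇ cap (suc b)))) (dec-true (suc b ≟ℕ suc b) refl) (+-comm q p))
                 (count-below w p (cap (suc b))))
  ... | no b+1≮B =
    trans (sumTo-zero B λ b′ b′<B → sumTo-zero w λ q _ →
             cong (λ z → boolToℕ (z ∧ (q + p <ᵇ cap b′)))
                  (dec-false (b′ ≟ℕ suc b) λ { refl → b+1≮B b′<B }))
          (sym (begin
            w ⊓ (cap (suc b) ∸ p)   ≡⟨ cong (λ c → w ⊓ (c ∸ p)) cap-B ⟩
            w ⊓ (0 ∸ p)             ≡⟨ cong (w ⊓_) (0∸n≡0 p) ⟩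
            w ⊓ 0                   ≡⟨ ⊓-zeroʳ w ⟩
            0                       ∎))
    where
    open ≡-Reasoning
    cap-B : cap (suc b) ≡ 0
    cap-B = trans (cong cap (≤-antisym b<B (≮⇒≥ b+1≮B))) (trans (cong (B ⊓_) (n∸n≡0 B)) (⊓-zeroʳ B))

  leaf-degrees-close : ∀ b p → Close (leafOut b p) (leafIn b p)
  leaf-degrees-close b p =
    close-⊓ (close-refl w) (close-∸ p (close-⊓ (close-suc b) (close-∸suc B b)))

  block<B : ∀ k → k < L → k / w < B
  block<B k k<L = m<n*o⇒m/o<n k<L

  leaf-out : ∀ k → k < L → sumTo L (λ j → boolToℕ (arcRel (3 + k) (3 + j))) ≡ outᴸ k
  leaf-out k k<L =
    trans (sumTo-divMod B w (λ b′ q → boolToℕ (leafArc (k / w) (k % w) b′ q)))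
          (leaf-out-degree (k / w) (k % w) (block<B k k<L))

  leaf-in : ∀ k → k < L → sumTo L (λ j → boolToℕ (arcRel (3 + j) (3 + k))) ≡ inᴸ k
  leaf-in k k<L =
    trans (sumTo-divMod B w (λ b′ q → boolToℕ (leafArc b′ q (k / w) (k % w))))
          (leaf-in-degree (k / w) (k % w) (block<B k k<L))

  -- A leaf gets one arc from 2, one arc to 2, its leaf arcs, and the repairing arc with 0.
  leaf-balanced : ∀ k → k < L → inRel n arcRel (3 + k) ≡ outRel n arcRel (3 + k)
  leaf-balanced k k<L = begin
      boolToℕ (inᴸ k <ᵇ outᴸ k) + (0 + (1 + sumTo L (λ j → boolToℕ (arcRel (3 + j) (3 + k)))))
    ≡⟨ cong (λ d → boolToℕ (inᴸ k <ᵇ outᴸ k) + suc d) (leaf-in k k<L) ⟩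
      boolToℕ (inᴸ k <ᵇ outᴸ k) + suc (inᴸ k)
    ≡⟨ +-suc _ (inᴸ k) ⟩
      suc (boolToℕ (inᴸ k <ᵇ outᴸ k) + inᴸ k)
    ≡⟨ cong suc (top-up (leaf-degrees-close (k / w) (k % w))) ⟩
      suc (boolToℕ (outᴸ k <ᵇ inᴸ k) + outᴸ k)
    ≡⟨ sym (+-suc _ (outᴸ k)) ⟩
      boolToℕ (outᴸ k <ᵇ inᴸ k) + suc (outᴸ k)
    ≡⟨ cong (λ d → boolToℕ (outᴸ k <ᵇ inᴸ k) + suc d) (sym (leaf-out k k<L)) ⟩
      boolToℕ (outᴸ k <ᵇ inᴸ k) + (0 + (1 + sumTo L (λ j → boolToℕ (arcRel (3 + k) (3 + j)))))
    ∎
    where open ≡-Reasoning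

  balanced-off-0 : ∀ x → suc x < n → inRel n arcRel (suc x) ≡ outRel n arcRel (suc x)
  balanced-off-0 0             _   = refl
  balanced-off-0 1             _   = refl
  balanced-off-0 (suc (suc k)) x<n = leaf-balanced k (s<s⁻¹ (s<s⁻¹ (s<s⁻¹ x<n)))

  arcRel-irrefl : ∀ k → arcRel k k ≡ false
  arcRel-irrefl 0 = refl
  arcRel-irrefl 1 = refl
  arcRel-irrefl 2 = refl
  arcRel-irrefl (suc (suc (suc k))) =
    cong (_∧ (k % w + k % w <ᵇ cap (k / w))) (dec-false (k / w ≟ℕ suc (k / w)) (<⇒≢ (n<1+n (k / w))))

  -- Leaves only point to blocks of smaller index, hence to vertices of smaller index.
  leaf-no-forward-arc : ∀ k y → 3 + k < y → arcRel (3 + k) y ≡ false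
  leaf-no-forward-arc k 0 ()
  leaf-no-forward-arc k 1 (s<s ())
  leaf-no-forward-arc k 2 (s<s (s<s ()))
  leaf-no-forward-arc k (suc (suc (suc j))) k<j =
    cong (_∧ (k % w + j % w <ᵇ cap (k / w)))
         (dec-false (k / w ≟ℕ suc (j / w)) (λ k/w≡ → <⇒≱ (≤-reflexive (sym k/w≡)) block-k≤block-j))
    where
    block-k≤block-j : k / w ≤ j / w
    block-k≤block-j = /-monoˡ-≤ w (<⇒≤ (s<s⁻¹ (s<s⁻¹ (s<s⁻¹ k<j))))

  -- Blocks 2w ≤ b < 6w have capacity at least 2w, so all their leaves have leaf out-degree w.
  middle-leaf-out : ∀ i q → i < 4 * w → q < w → w ≤ leafOut (2 * w + i) q
  middle-leaf-out i q i<4w q<w =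
    ⊓-glb ≤-refl (m+n≤o⇒m≤o∸n w (⊓-glb below-b (m+n≤o⇒m≤o∸n (w + q) below-B-b)))
    where
    w+q≤2w : w + q ≤ 2 * w
    w+q≤2w = +-monoʳ-≤ w (≤-trans (<⇒≤ q<w) (≤-reflexive (sym (+-identityʳ w))))
    below-b : w + q ≤ 2 * w + i
    below-b = ≤-trans w+q≤2w (m≤m+n (2 * w) i)
    below-B-b : w + q + (2 * w + i) ≤ B
    below-B-b = ≤-trans (+-mono-≤ w+q≤2w (+-monoʳ-≤ (2 * w) (<⇒≤ i<4w)))
                        (≤-reflexive (solve 1 (λ x → con 2 :* x :+ (con 2 :* x :+ con 4 :* x) := con 8 :* x) refl w))

  -- The 4w middle blocks alone carry 4w · w · w leaf arcs.
  leaf-arcs-lower-bound : 4 * w * (w * w) ≤ leafDoubleSum leafOut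
  leaf-arcs-lower-bound = begin
      4 * w * (w * w)
    ≡⟨ sym (sumTo-const (4 * w) (w * w)) ⟩
      sumTo (4 * w) (λ _ → w * w)
    ≡⟨ sumTo-cong (4 * w) (λ _ _ → sym (sumTo-const w w)) ⟩
      sumTo (4 * w) (λ _ → sumTo w (λ _ → w))
    ≤⟨ sumTo-mono (4 * w) (λ i i<4w → sumTo-mono w (λ q q<w → middle-leaf-out i q i<4w q<w)) ⟩
      sumTo (4 * w) (λ i → blockSum (2 * w + i))
    ≤⟨ m≤m+n _ _ ⟩
      sumTo (4 * w) (λ i → blockSum (2 * w + i)) + sumTo (2 * w) (λ i → blockSum (2 * w + (4 * w + i)))
    ≡⟨ sym (sumTo-split (4 * w) (2 * w) (λ i → blockSum (2 * w + i))) ⟩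
      sumTo (4 * w + 2 * w) (λ i → blockSum (2 * w + i))
    ≤⟨ m≤n+m _ (sumTo (2 * w) blockSum) ⟩
      sumTo (2 * w) blockSum + sumTo (4 * w + 2 * w) (λ i → blockSum (2 * w + i))
    ≡⟨ sym (sumTo-split (2 * w) (4 * w + 2 * w) blockSum) ⟩
      sumTo (2 * w + (4 * w + 2 * w)) blockSum
    ≡⟨ cong (λ c → sumTo c blockSum) (solve 1 (λ x → con 2 :* x :+ (con 4 :* x :+ con 2 :* x) := con 8 :* x)
                                            refl w) ⟩
      leafDoubleSum leafOut
    ∎
    where
    open ≤-Reasoning
    blockSum : ℕ → ℕ
    blockSum b = sumTo w (leafOut b)

  arcs-lower-bound : 4 * w * (w * w) ≤ sumTo n (outRel n arcRel)
  arcs-lower-bound = begin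
      4 * w * (w * w)                             ≤⟨ leaf-arcs-lower-bound ⟩
      leafDoubleSum leafOut                       ≡⟨ sym (sumTo-divMod B w leafOut) ⟩
      sumTo L outᴸ                                ≤⟨ sumTo-mono L leaf-out≤out ⟩
      sumTo L (λ k → outRel n arcRel (3 + k))     ≤⟨ m≤n+m _ (f 2) ⟩
      f 2 + sumTo L (λ k → f (3 + k))             ≤⟨ m≤n+m _ (f 1) ⟩
      f 1 + (f 2 + sumTo L (λ k → f (3 + k)))     ≤⟨ m≤n+m _ (f 0) ⟩
      sumTo n (outRel n arcRel)                   ∎
    where
    open ≤-Reasoning
    f : ℕ → ℕ
    f = outRel n arcRel
    leaf-out≤out : ∀ k → k < L → outᴸ k ≤ outRel n arcRel (3 + k)
    leaf-out≤out k k<L = ≤-trans (≤-reflexive (sym (leaf-out k k<L)))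
                                 (≤-trans (m≤n+m _ 1) (≤-trans (m≤n+m _ 0) (m≤n+m _ _)))

  -- n = 3 + 8w² ≤ 11w², and (11w²)³ ≤ 6400 w⁶ = (20 · 4w³)².
  size-bound : ∀ m → 4 * w * (w * w) ≤ m → n ^ 3 ≤ (20 * m) ^ 2
  size-bound m 4w³≤m = begin
      n ^ 3                        ≤⟨ ^-monoˡ-≤ 3 n≤11w² ⟩
      (11 * (w * w)) ^ 3           ≡⟨ solve 1 (λ x → (con 11 :* (x :* x)) :^ 3 := con 1331 :* (x :* x) :^ 3)
                                            refl w ⟩
      1331 * (w * w) ^ 3           ≤⟨ *-monoˡ-≤ ((w * w) ^ 3) (m≤m+n 1331 5069) ⟩
      6400 * (w * w) ^ 3           ≡⟨ solve 1 (λ x → con 6400 :* (x :* x) :^ 3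
                                                  := (con 20 :* (con 4 :* x :* (x :* x))) :^ 2) refl w ⟩
      (20 * (4 * w * (w * w))) ^ 2 ≤⟨ ^-monoˡ-≤ 2 (*-monoʳ-≤ 20 4w³≤m) ⟩
      (20 * m) ^ 2                 ∎
    where
    open ≤-Reasoning
    n≤11w² : n ≤ 11 * (w * w)
    n≤11w² = ≤-trans (+-mono-≤ (*-monoʳ-≤ 3 (s≤s z≤n)) (≤-reflexive (*-assoc 8 w w)))
                     (≤-reflexive (sym (*-distribʳ-+ (w * w) 3 8)))

  G : Digraph n
  G = relDigraph n arcRel arcRel-irrefl

  G-eulerian : Eulerian G
  G-eulerian = relDigraph-eulerian n arcRel arcRel-irrefl balanced-off-0

  G-arcs : 4 * w * (w * w) ≤ arcCount G
  G-arcs = subst (4 * w * (w * w) ≤_) (sym (relDigraph-arcCount n arcRel arcRel-irrefl))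
                 arcs-lower-bound

  v₀ v₁ v₂ : Fin n
  v₀ = zero
  v₁ = suc zero
  v₂ = suc (suc zero)

  T₀ : Subset n
  T₀ = ⊤ - v₀ - v₁ - v₂

  p₀ : Parent n
  p₀ = setParent (setParent (λ _ → nothing) v₁ v₀) v₂ v₁

  tail₁ : IsTailFrom 1 (⊤ - v₀)
  tail₁ = tail-remove v₀ ⊤-isTailFrom-0 refl

  tail₂ : IsTailFrom 2 (⊤ - v₀ - v₁)
  tail₂ = tail-remove v₁ tail₁ refl

  T₀-isTailFrom-3 : IsTailFrom 3 T₀
  T₀-isTailFrom-3 = tail-remove v₂ tail₂ refl

  opening : DFSRun G (initState n) (st ⊥ T₀ (v₂ ∷ v₁ ∷ v₀ ∷ []) p₀)
  opening =
    step (root ∈⊤)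
    (step (push (proj₂ (tail₁ v₁) (s≤s z≤n)) refl)
    (step (push (proj₂ (tail₂ v₂) (s≤s (s≤s z≤n))) refl)
     done))

  hub-arcs : ∀ x → 3 ≤ toℕ x → arc G v₂ x ≡ true
  hub-arcs (suc zero)          (s≤s ())
  hub-arcs (suc (suc zero))    (s≤s (s≤s ()))
  hub-arcs (suc (suc (suc k))) _ = refl

  no-forward-arcs : ∀ x y → 3 ≤ toℕ x → toℕ x < toℕ y → arc G x y ≡ false
  no-forward-arcs (suc zero)          y (s≤s ())
  no-forward-arcs (suc (suc zero))    y (s≤s (s≤s ()))
  no-forward-arcs (suc (suc (suc k))) y _ x<y = leaf-no-forward-arc (toℕ k) (toℕ y) x<y

  open Sweep G v₂ (v₁ ∷ v₀ ∷ []) 3 hub-arcs no-forward-arcs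

  leaves-swept : Swept ⊥ T₀ p₀ 3
  leaves-swept = sweep L 3 (+-comm L 3) ≤-refl T₀-isTailFrom-3

  open Swept leaves-swept

  S-final : Subset n
  S-final = ((S′ ∪ ⁅ v₂ ⁆) ∪ ⁅ v₁ ⁆) ∪ ⁅ v₀ ⁆

  closing : DFSRun G (st S′ T′ (v₂ ∷ v₁ ∷ v₀ ∷ []) p′) (st S-final T′ [] p′)
  closing =
    step (pop (nothing-left v₂)) (step (pop (nothing-left v₁)) (step (pop (nothing-left v₀)) done))
    where
    nothing-left : ∀ x u → u ∈ T′ → arc G x u ≡ false
    nothing-left x u u∈T′ = ⊥-elim (exhausted u u∈T′)

  all-finished : S-final ≡ ⊤
  all-finished = ⊆-antisym ⊆⊤ (λ {i} _ → finished i)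
    where
    finished : ∀ i → i ∈ S-final
    finished zero                = x∈p∪q⁺ (inj₂ (x∈⁅x⁆ v₀))
    finished (suc zero)          = p⊆p∪q ⁅ v₀ ⁆ (x∈p∪q⁺ (inj₂ (x∈⁅x⁆ v₁)))
    finished (suc (suc zero))    = p⊆p∪q ⁅ v₀ ⁆ (p⊆p∪q ⁅ v₁ ⁆ (x∈p∪q⁺ (inj₂ (x∈⁅x⁆ v₂))))
    finished i@(suc (suc (suc _))) =
      p⊆p∪q ⁅ v₀ ⁆ (p⊆p∪q ⁅ v₁ ⁆ (p⊆p∪q ⁅ v₂ ⁆ (finishes i (s≤s (s≤s (s≤s z≤n))))))

  dfsTree : Parent n
  dfsTree = p′

  G-dfsTree : IsDFSTree G dfsTree
  G-dfsTree = T′ , [] , subst (λ S → DFSRun G (initState n) (st S T′ [] p′)) all-finished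
                              (opening ++ᴿ (run ++ᴿ closing))

  rank : Fin n → ℕ
  rank zero             = 0
  rank (suc zero)       = 1
  rank (suc (suc zero)) = 2
  rank _                = 3

  ranked : ∀ x → p′ x ≡ nothing ⊎ Σ (Fin n) λ u → p′ x ≡ just u × rank x ≡ suc (rank u)
  ranked zero             = inj₁ (keeps-parent v₀ (s≤s z≤n))
  ranked (suc zero)       = inj₂ (v₀ , keeps-parent v₁ (s≤s (s≤s z≤n)) , refl)
  ranked (suc (suc zero)) = inj₂ (v₁ , keeps-parent v₂ (s≤s (s≤s (s≤s z≤n))) , refl)
  ranked x@(suc (suc (suc _))) = inj₂ (v₂ , hub-parent x (s≤s (s≤s (s≤s z≤n))) , refl)

  G-depth : DepthAtMost dfsTree 4
  G-depth = depth-from-rank p′ rank ranked 4 rank<4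
    where
    rank<4 : ∀ x → rank x < 4
    rank<4 zero             = s≤s z≤n
    rank<4 (suc zero)       = s≤s (s≤s z≤n)
    rank<4 (suc (suc zero)) = s≤s (s≤s (s≤s z≤n))
    rank<4 (suc (suc (suc _))) = ≤-refl

  v≤n : v ≤ n
  v≤n = ≤-trans (n≤1+n v) (≤-trans (m≤n*m w 8) (≤-trans (m≤m*n B w) (m≤n+m L 3)))

proposition4p1 : ∀ (N : ℕ) → Σ ℕ λ n → N ≤ n × 1 ≤ n × Σ (Digraph n) λ G →
                   Eulerian G × n ^ 3 ≤ (20 * arcCount G) ^ 2 ×
                   Σ (Fin n → Maybe (Fin n)) λ p → IsDFSTree G p × DepthAtMost p 4
proposition4p1 N =
  n , v≤n , s≤s z≤n , G , G-eulerian , size-bound (arcCount G) G-arcs , dfsTree , G-dfsTree , G-depth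
  where open Construction N
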